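{- For every integer $L\geq 0$, \[ \sum_{j=-\infty}^{\infty}(-1)^jq^{2j^2-j}{2L \brack L-2j-1}_q=(-q^2;q^2)_{L-2}\left\{(1+q^L)(1-q^{2L})+q^{L-1}(1-q^L)(1+q^2)\right\}. \]
   Context: For integers $n\geq 0$, $(a;q)_n=\prod_{j=0}^{n-1}(1-aq^j)$ and $(a;q)_{ -n}=1/(a/q;1/q)_n$ (so, with base $q^2$, $(a;q^2)_{ -n}=1/(aq^{ -2};q^{ -2})_n$); $(q)_n=(q;q)_n$. For integers $m,n$, ${n+m \brack n}_q=\frac{(q)_{n+m}}{(q)_n(q)_m}$ if $m,n\geq 0$ and $0$ otherwise. -}

module Defs where

open import Level using (Level)
open import Algebra.Bundles using (CommutativeRing)
open import Data.Nat as ℕ using (ℕ; zero; suc)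
open import Data.Integer as ℤ using (ℤ; +_; -[1+_])

-- Everything is interpreted in an arbitrary commutative ring R with a
-- chosen element q and a chosen inverse q⁻ of q.
module QDefs {c ℓ : Level} (R : CommutativeRing c ℓ) where
  open CommutativeRing R

  _^_ : Carrier → ℕ → Carrier
  x ^ zero  = 1#
  x ^ suc n = x * (x ^ n)

  zpow : Carrier → Carrier → ℤ → Carrier
  zpow x x⁻ (+ n)     = x ^ n
  zpow x x⁻ -[1+ n ]  = x⁻ ^ suc n

  poch : Carrier → Carrier → ℕ → Carrier
  poch a b zero    = 1#
  poch a b (suc n) = poch a b n * (1# - a * (b ^ n))

  -- (a;b)_N for N ∈ ℤ, written as numerator / denominator, where b⁻ is an
  -- inverse of b:  (a;b)_{-n} = 1 / (a b⁻ ; b⁻)_n.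
  pochNum : Carrier → Carrier → Carrier → ℤ → Carrier
  pochNum a b b⁻ (+ n)    = poch a b n
  pochNum a b b⁻ -[1+ n ] = 1#

  pochDen : Carrier → Carrier → Carrier → ℤ → Carrier
  pochDen a b b⁻ (+ n)    = 1#
  pochDen a b b⁻ -[1+ n ] = poch (a * b⁻) b⁻ (suc n)

  gbin : Carrier → ℕ → ℕ → Carrier
  gbin q zero    zero    = 1#
  gbin q zero    (suc k) = 0#
  gbin q (suc n) zero    = 1#
  gbin q (suc n) (suc k) = gbin q n k + (q ^ suc k) * gbin q n (suc k)

  qbr : Carrier → ℕ → ℤ → Carrier
  qbr q N (+ k)    = gbin q N k
  qbr q N -[1+ k ] = 0#

  sumFrom : (ℤ → Carrier) → ℤ → ℕ → Carrier
  sumFrom f s zero    = 0#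
  sumFrom f s (suc n) = sumFrom f s n + f (s ℤ.+ + n)

  term : Carrier → Carrier → ℕ → ℤ → Carrier
  term q q⁻ L j =
    zpow (- 1#) (- 1#) j
    * zpow q q⁻ ((+ 2) ℤ.* j ℤ.* j ℤ.- j)
    * qbr q (2 ℕ.* L) (+ L ℤ.- (+ 2) ℤ.* j ℤ.- + 1)

  -- the bilateral sum; summands vanish unless -(L+1) ≤ j ≤ L,
  -- so summing over j ∈ [-(L+1), L] (2L+2 terms) is the full sum.
  lhs : Carrier → Carrier → ℕ → Carrier
  lhs q q⁻ L = sumFrom (term q q⁻ L) (ℤ.- (+ suc L)) (2 ℕ.* L ℕ.+ 2)

  braces : Carrier → Carrier → ℕ → Carrier
  braces q q⁻ L =
    (1# + q ^ L) * (1# - q ^ (2 ℕ.* L))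
    + zpow q q⁻ (+ L ℤ.- + 1) * (1# - q ^ L) * (1# + q ^ 2)

{-# OPTIONS --safe #-}

-- Over R[i] = R[X]/(X² + 1) take x = i, N = 2L and a = L - 1 in the bilateral q-binomial theorem
--   Σₖ xᵏ q^(k(k-1)/2) [N, a - k] = xᵃ q^(a(a-1)/2) (-x⁻¹ q^(1-a); q)_N.
-- The terms with k = 2j even are the summands (-1)ʲ q^(2j²-j) [2L, L-2j-1] of the left-hand side,
-- those with k odd are purely imaginary, so the left-hand side is the real part of the product.
-- For L = n + 2 the factors 1 - i q^m, m = -n … n, of the product pair up as
--   (1 - i q^(-m)) (1 - i q^m) q^m = -i (1 + q^(2m)),
-- which leaves (1 - i) (-i)ⁿ (-q²; q²)ₙ times the three factors with m = n + 1, n + 2, n + 3,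
-- and the real part of these is the bracket. The cases L = 0, 1 are computed directly.

module Submission where

open import Defs
open import Level using (Level)
open import Algebra.Bundles using (AbelianGroup; CommutativeRing)
import Algebra.Construct.DirectProduct as DirectProduct
open import Algebra.Morphism.Structures using (IsRingHomomorphism)
open import Data.Nat as ℕ using (ℕ; zero; suc)
open import Data.Integer as ℤ using (ℤ; +_; -[1+_]; _⊖_; _◃_; sign; ∣_∣)
import Data.Integer.Properties as ℤP
import Data.Nat.Properties as ℕP
open import Data.Maybe using (Maybe; just; nothing)
open import Data.Sign as Sign using (Sign)
open import Relation.Nullary using (yes; no; contradiction)
open import Relation.Binary.PropositionalEquality as ≡ using (_≡_; _≢_)
open import Function using (_∘_)
import Algebra.Solver.Ring
open import Data.Integer.Tactic.RingSolver using (solve-∀)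
open import Data.Nat.Tactic.RingSolver using () renaming (solve-∀ to ℕ-solve-∀)
import Algebra.Solver.Ring.AlmostCommutativeRing as ACR

-- Tactic.RingSolver takes its coefficients from the ring itself, where they cannot be compared
-- in an abstract ring, so we instantiate Algebra.Solver.Ring with integer coefficients instead.
module ℤ-Solver {c ℓ : Level} (R : CommutativeRing c ℓ) where
  open CommutativeRing R
  open import Algebra.Properties.Ring ring using (-0#≈0#; -‿involutive; -‿+-comm; -‿distribˡ-*; -‿distribʳ-*)
  open import Algebra.Properties.Semiring.Mult.TCOptimised semiring using (_×_; 1+×; ×-homo-+; ×1-homo-*)
  open import Algebra.Properties.CommutativeSemigroup +-commutativeSemigroup using (interchange)
  open import Relation.Binary.Reasoning.Setoid setoid

  signed : Sign → Carrier → Carrier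
  signed Sign.+ x = x
  signed Sign.- x = - x

  fromℤ : ℤ → Carrier
  fromℤ i = signed (sign i) (∣ i ∣ × 1#)

  private
    fromℤ-◃ : ∀ s n → fromℤ (s ◃ n) ≈ signed s (n × 1#)
    fromℤ-◃ Sign.+ zero    = refl
    fromℤ-◃ Sign.- zero    = sym -0#≈0#
    fromℤ-◃ Sign.+ (suc n) = refl
    fromℤ-◃ Sign.- (suc n) = refl

    signed-* : ∀ s t x y → signed (s Sign.* t) (x * y) ≈ signed s x * signed t y
    signed-* Sign.+ Sign.+ x y = refl
    signed-* Sign.+ Sign.- x y = -‿distribʳ-* x y
    signed-* Sign.- Sign.+ x y = -‿distribˡ-* x y
    signed-* Sign.- Sign.- x y = begin
      x * y         ≈⟨ -‿involutive _ ⟨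
      - - (x * y)   ≈⟨ -‿cong (-‿distribʳ-* x y) ⟩
      - (x * - y)   ≈⟨ -‿distribˡ-* x (- y) ⟩
      - x * - y     ∎

    signed-cong : ∀ s {x y} → x ≈ y → signed s x ≈ signed s y
    signed-cong Sign.+ x≈y = x≈y
    signed-cong Sign.- x≈y = -‿cong x≈y

    fromℤ-⊖ : ∀ m n → fromℤ (m ⊖ n) ≈ m × 1# - n × 1#
    fromℤ-⊖ m       zero    = sym (trans (+-congˡ -0#≈0#) (+-identityʳ _))
    fromℤ-⊖ zero    (suc n) = sym (+-identityˡ _)
    fromℤ-⊖ (suc m) (suc n) = begin
      fromℤ (suc m ⊖ suc n)           ≡⟨ ≡.cong fromℤ (ℤP.[1+m]⊖[1+n]≡m⊖n m n) ⟩
      fromℤ (m ⊖ n)                   ≈⟨ fromℤ-⊖ m n ⟩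
      m × 1# - n × 1#                 ≈⟨ +-identityˡ _ ⟨
      0# + (m × 1# - n × 1#)          ≈⟨ +-congʳ (-‿inverseʳ 1#) ⟨
      (1# - 1#) + (m × 1# - n × 1#)   ≈⟨ interchange _ _ _ _ ⟩
      (1# + m × 1#) + (- 1# - n × 1#) ≈⟨ +-congˡ (-‿+-comm _ _) ⟩
      (1# + m × 1#) - (1# + n × 1#)   ≈⟨ +-cong (1+× m 1#) (-‿cong (1+× n 1#)) ⟨
      suc m × 1# - suc n × 1#         ∎

    fromℤ-+ : ∀ i j → fromℤ (i ℤ.+ j) ≈ fromℤ i + fromℤ j
    fromℤ-+ (+ m)    (+ n)    = ×-homo-+ 1# m n
    fromℤ-+ (+ m)    -[1+ n ] = fromℤ-⊖ m (suc n)
    fromℤ-+ -[1+ m ] (+ n)    = trans (fromℤ-⊖ n (suc m)) (+-comm _ _)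
    fromℤ-+ -[1+ m ] -[1+ n ] = begin
      - (suc (suc (m ℕ.+ n)) × 1#)       ≡⟨ ≡.cong (λ k → - (suc k × 1#)) (≡.sym (ℕP.+-suc m n)) ⟩
      - ((suc m ℕ.+ suc n) × 1#)         ≈⟨ -‿cong (×-homo-+ 1# (suc m) (suc n)) ⟩
      - (suc m × 1# + suc n × 1#)        ≈⟨ -‿+-comm _ _ ⟨
      - (suc m × 1#) + - (suc n × 1#)    ∎

    fromℤ-* : ∀ i j → fromℤ (i ℤ.* j) ≈ fromℤ i * fromℤ j
    fromℤ-* i j = begin
      fromℤ (s Sign.* t ◃ m ℕ.* n)              ≈⟨ fromℤ-◃ (s Sign.* t) (m ℕ.* n) ⟩
      signed (s Sign.* t) ((m ℕ.* n) × 1#)      ≈⟨ signed-cong (s Sign.* t) (×1-homo-* m n) ⟩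
      signed (s Sign.* t) (m × 1# * n × 1#)     ≈⟨ signed-* s t (m × 1#) (n × 1#) ⟩
      fromℤ i * fromℤ j                         ∎
      where
      s = sign i
      t = sign j
      m = ∣ i ∣
      n = ∣ j ∣

    fromℤ-neg : ∀ i → fromℤ (ℤ.- i) ≈ - fromℤ i
    fromℤ-neg (+ zero)  = sym -0#≈0#
    fromℤ-neg (+ suc n) = refl
    fromℤ-neg -[1+ n ]  = sym (-‿involutive _)

  open ACR using (_-Raw-AlmostCommutative⟶_; fromCommutativeRing)

  fromℤ-homomorphism : ℤ.+-*-rawRing -Raw-AlmostCommutative⟶ fromCommutativeRing R
  fromℤ-homomorphism = record
    { ⟦_⟧    = fromℤ
    ; +-homo = fromℤ-+
    ; *-homo = fromℤ-*
    ; -‿homo = fromℤ-neg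
    ; 0-homo = refl
    ; 1-homo = refl
    }

  private
    fromℤ-≟ : ∀ i j → Maybe (fromℤ i ≈ fromℤ j)
    fromℤ-≟ i j with i ℤ.≟ j
    ... | yes i≡j = just (reflexive (≡.cong fromℤ i≡j))
    ... | no _    = nothing

  open Algebra.Solver.Ring ℤ.+-*-rawRing (fromCommutativeRing R) fromℤ-homomorphism fromℤ-≟ public

-- triangle n = n (n - 1) / 2, and tri k = k (k - 1) / 2 for every k ∈ ℤ.
triangle : ℕ → ℕ
triangle zero    = 0
triangle (suc n) = triangle n ℕ.+ n

tri : ℤ → ℕ
tri (+ n)    = triangle n
tri -[1+ n ] = triangle (suc (suc n))

tri-suc : ∀ k → + tri (ℤ.suc k) ≡ + tri k ℤ.+ k
tri-suc (+ n)        = ≡.refl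
tri-suc -[1+ zero ]  = ≡.refl
tri-suc -[1+ suc n ] = arith (+ triangle (suc (suc n))) (+ suc (suc n))
  where
  arith : ∀ t m → t ≡ t ℤ.+ m ℤ.- m
  arith = solve-∀

tri-pred : ∀ a → + tri (a ℤ.- + 1) ≡ + tri a ℤ.+ (+ 1 ℤ.- a)
tri-pred a = begin
  + tri (a ℤ.- + 1)                                ≡⟨ arith₁ (+ tri (a ℤ.- + 1)) a ⟩
  + tri (a ℤ.- + 1) ℤ.+ (a ℤ.- + 1) ℤ.+ (+ 1 ℤ.- a) ≡⟨ ≡.cong (ℤ._+ (+ 1 ℤ.- a)) (tri-suc (a ℤ.- + 1)) ⟨
  + tri (ℤ.suc (a ℤ.- + 1)) ℤ.+ (+ 1 ℤ.- a)        ≡⟨ ≡.cong (λ k → + tri k ℤ.+ (+ 1 ℤ.- a)) (arith₂ a) ⟩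
  + tri a ℤ.+ (+ 1 ℤ.- a)                          ∎
  where
  open ≡.≡-Reasoning
  arith₁ : ∀ t a → t ≡ t ℤ.+ (a ℤ.- + 1) ℤ.+ (+ 1 ℤ.- a)
  arith₁ = solve-∀
  arith₂ : ∀ a → + 1 ℤ.+ (a ℤ.- + 1) ≡ a
  arith₂ = solve-∀

triangle-double : ∀ n → + triangle (n ℕ.+ n) ≡ + 2 ℤ.* + n ℤ.* + n ℤ.- + n
triangle-double zero    = ≡.refl
triangle-double (suc n) = begin
  + triangle (suc n ℕ.+ suc n)
    ≡⟨ ≡.cong (λ m → + triangle (suc m)) (ℕP.+-suc n n) ⟩
  + triangle (n ℕ.+ n) ℤ.+ (+ n ℤ.+ + n) ℤ.+ (+ 1 ℤ.+ (+ n ℤ.+ + n))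
    ≡⟨ ≡.cong (λ t → t ℤ.+ (+ n ℤ.+ + n) ℤ.+ (+ 1 ℤ.+ (+ n ℤ.+ + n))) (triangle-double n) ⟩
  + 2 ℤ.* + n ℤ.* + n ℤ.- + n ℤ.+ (+ n ℤ.+ + n) ℤ.+ (+ 1 ℤ.+ (+ n ℤ.+ + n))
    ≡⟨ arith (+ n) ⟩
  + 2 ℤ.* (+ 1 ℤ.+ + n) ℤ.* (+ 1 ℤ.+ + n) ℤ.- (+ 1 ℤ.+ + n) ∎
  where
  open ≡.≡-Reasoning
  arith : ∀ n → + 2 ℤ.* n ℤ.* n ℤ.- n ℤ.+ (n ℤ.+ n) ℤ.+ (+ 1 ℤ.+ (n ℤ.+ n))
              ≡ + 2 ℤ.* (+ 1 ℤ.+ n) ℤ.* (+ 1 ℤ.+ n) ℤ.- (+ 1 ℤ.+ n)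
  arith = solve-∀

tri-double : ∀ j → + tri (j ℤ.+ j) ≡ + 2 ℤ.* j ℤ.* j ℤ.- j
tri-double (+ n)    = triangle-double n
tri-double -[1+ n ] = begin
  + triangle (suc (suc (n ℕ.+ n))) ℤ.+ + suc (suc (n ℕ.+ n))
    ≡⟨ ≡.cong (λ m → + triangle m ℤ.+ + m) (ℕP.+-suc (suc n) n) ⟨
  + triangle (suc n ℕ.+ suc n) ℤ.+ (+ suc n ℤ.+ + suc n)
    ≡⟨ ≡.cong (ℤ._+ (+ suc n ℤ.+ + suc n)) (triangle-double (suc n)) ⟩
  + 2 ℤ.* + suc n ℤ.* + suc n ℤ.- + suc n ℤ.+ (+ suc n ℤ.+ + suc n)
    ≡⟨ arith (+ suc n) ⟩
  + 2 ℤ.* -[1+ n ] ℤ.* -[1+ n ] ℤ.- -[1+ n ] ∎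
  where
  open ≡.≡-Reasoning
  arith : ∀ m → + 2 ℤ.* m ℤ.* m ℤ.- m ℤ.+ (m ℤ.+ m) ≡ + 2 ℤ.* (ℤ.- m) ℤ.* (ℤ.- m) ℤ.- (ℤ.- m)
  arith = solve-∀

module Exponentiation {c ℓ : Level} (R : CommutativeRing c ℓ) where
  open CommutativeRing R
  open QDefs R
  open import Algebra.Properties.CommutativeSemigroup *-commutativeSemigroup using (interchange)
  open import Relation.Binary.Reasoning.Setoid setoid

  ^-congˡ : ∀ n {x y} → x ≈ y → x ^ n ≈ y ^ n
  ^-congˡ zero    x≈y = refl
  ^-congˡ (suc n) x≈y = *-cong x≈y (^-congˡ n x≈y)

  ^-homo-* : ∀ x m n → x ^ (m ℕ.+ n) ≈ x ^ m * x ^ n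
  ^-homo-* x zero    n = sym (*-identityˡ _)
  ^-homo-* x (suc m) n = trans (*-congˡ (^-homo-* x m n)) (sym (*-assoc _ _ _))

  ^-distrib-* : ∀ x y n → (x * y) ^ n ≈ x ^ n * y ^ n
  ^-distrib-* x y zero    = sym (*-identityˡ 1#)
  ^-distrib-* x y (suc n) = trans (*-congˡ (^-distrib-* x y n)) (interchange x y (x ^ n) (y ^ n))

  ^-inverse : ∀ {x x⁻} → x * x⁻ ≈ 1# → ∀ n → x ^ n * x⁻ ^ n ≈ 1#
  ^-inverse xx⁻≈1 n = trans (sym (^-distrib-* _ _ n)) (trans (^-congˡ n xx⁻≈1) (1^ n))
    where
    1^ : ∀ n → 1# ^ n ≈ 1#
    1^ zero    = refl
    1^ (suc n) = trans (*-identityˡ _) (1^ n)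

  ^-cancelˡ : ∀ {x x⁻} → x * x⁻ ≈ 1# → ∀ m n → x⁻ ^ m * x ^ (m ℕ.+ n) ≈ x ^ n
  ^-cancelˡ {x} {x⁻} xx⁻≈1 m n = begin
    x⁻ ^ m * x ^ (m ℕ.+ n)     ≈⟨ *-congˡ (^-homo-* x m n) ⟩
    x⁻ ^ m * (x ^ m * x ^ n)   ≈⟨ *-assoc _ _ _ ⟨
    x⁻ ^ m * x ^ m * x ^ n     ≈⟨ *-congʳ (trans (*-comm _ _) (^-inverse xx⁻≈1 m)) ⟩
    1# * x ^ n                 ≈⟨ *-identityˡ _ ⟩
    x ^ n                      ∎

  zpow-cong : ∀ a {x x⁻ y y⁻} → x ≈ y → x⁻ ≈ y⁻ → zpow x x⁻ a ≈ zpow y y⁻ a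
  zpow-cong (+ n)    x≈y x⁻≈y⁻ = ^-congˡ n x≈y
  zpow-cong -[1+ n ] x≈y x⁻≈y⁻ = ^-congˡ (suc n) x⁻≈y⁻

  zpow-neg : ∀ x x⁻ a → zpow x x⁻ (ℤ.- a) ≡ zpow x⁻ x a
  zpow-neg x x⁻ (+ zero)  = ≡.refl
  zpow-neg x x⁻ (+ suc n) = ≡.refl
  zpow-neg x x⁻ -[1+ n ]  = ≡.refl

  zpow-distrib-* : ∀ x x⁻ y y⁻ a → zpow (x * y) (x⁻ * y⁻) a ≈ zpow x x⁻ a * zpow y y⁻ a
  zpow-distrib-* x x⁻ y y⁻ (+ n)    = ^-distrib-* x y n
  zpow-distrib-* x x⁻ y y⁻ -[1+ n ] = ^-distrib-* x⁻ y⁻ (suc n)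

  zpow-inverse : ∀ {x x⁻} → x * x⁻ ≈ 1# → ∀ a → zpow x x⁻ a * zpow x⁻ x a ≈ 1#
  zpow-inverse xx⁻≈1 (+ n)    = ^-inverse xx⁻≈1 n
  zpow-inverse xx⁻≈1 -[1+ n ] = trans (*-comm _ _) (^-inverse xx⁻≈1 (suc n))

  module _ {x x⁻ : Carrier} (xx⁻≈1 : x * x⁻ ≈ 1#) where

    zpow-⊖ : ∀ m n → zpow x x⁻ (m ⊖ n) ≈ x ^ m * x⁻ ^ n
    zpow-⊖ m       zero    = sym (*-identityʳ _)
    zpow-⊖ zero    (suc n) = sym (*-identityˡ _)
    zpow-⊖ (suc m) (suc n) = begin
      zpow x x⁻ (suc m ⊖ suc n)        ≡⟨ ≡.cong (zpow x x⁻) (ℤP.[1+m]⊖[1+n]≡m⊖n m n) ⟩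
      zpow x x⁻ (m ⊖ n)                ≈⟨ zpow-⊖ m n ⟩
      x ^ m * x⁻ ^ n                   ≈⟨ *-identityˡ _ ⟨
      1# * (x ^ m * x⁻ ^ n)            ≈⟨ *-congʳ xx⁻≈1 ⟨
      (x * x⁻) * (x ^ m * x⁻ ^ n)      ≈⟨ interchange x x⁻ (x ^ m) (x⁻ ^ n) ⟩
      x ^ suc m * x⁻ ^ suc n           ∎

    zpow-homo-+ : ∀ a b → zpow x x⁻ (a ℤ.+ b) ≈ zpow x x⁻ a * zpow x x⁻ b
    zpow-homo-+ (+ m)    (+ n)    = ^-homo-* x m n
    zpow-homo-+ (+ m)    -[1+ n ] = zpow-⊖ m (suc n)
    zpow-homo-+ -[1+ m ] (+ n)    = trans (zpow-⊖ n (suc m)) (*-comm _ _)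
    zpow-homo-+ -[1+ m ] -[1+ n ] = begin
      x⁻ ^ suc (suc (m ℕ.+ n))   ≡⟨ ≡.cong (λ k → x⁻ ^ suc k) (ℕP.+-suc m n) ⟨
      x⁻ ^ (suc m ℕ.+ suc n)     ≈⟨ ^-homo-* x⁻ (suc m) (suc n) ⟩
      x⁻ ^ suc m * x⁻ ^ suc n    ∎

module Summation {c ℓ : Level} (R : CommutativeRing c ℓ) where
  open CommutativeRing R
  open QDefs R
  open import Algebra.Properties.CommutativeSemigroup +-commutativeSemigroup using (interchange)
  open import Algebra.Properties.AbelianGroup ℤP.+-0-abelianGroup using () renaming (∙-cancelˡ to ℤ-+-cancelˡ)
  open import Relation.Binary.Reasoning.Setoid setoid

  private
    offset-injective : ∀ s {t u} → s ℤ.+ + t ≡ s ℤ.+ + u → t ≡ u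
    offset-injective s eq = ℤP.+-injective (ℤ-+-cancelˡ s _ _ eq)

  sumFrom-cong : ∀ {f g} s n → (∀ k → f k ≈ g k) → sumFrom f s n ≈ sumFrom g s n
  sumFrom-cong s zero    f≈g = refl
  sumFrom-cong s (suc n) f≈g = +-cong (sumFrom-cong s n f≈g) (f≈g _)

  sumFrom-distrib-+ : ∀ f g s n → sumFrom (λ k → f k + g k) s n ≈ sumFrom f s n + sumFrom g s n
  sumFrom-distrib-+ f g s zero    = sym (+-identityˡ 0#)
  sumFrom-distrib-+ f g s (suc n) = trans (+-congʳ (sumFrom-distrib-+ f g s n)) (interchange _ _ _ _)

  *-distribˡ-sumFrom : ∀ a f s n → a * sumFrom f s n ≈ sumFrom (λ k → a * f k) s n
  *-distribˡ-sumFrom a f s zero    = zeroʳ a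
  *-distribˡ-sumFrom a f s (suc n) = trans (distribˡ a _ _) (+-congʳ (*-distribˡ-sumFrom a f s n))

  sumFrom-vanishing : ∀ f s n → (∀ t → t ℕ.< n → f (s ℤ.+ + t) ≈ 0#) → sumFrom f s n ≈ 0#
  sumFrom-vanishing f s zero    f≈0 = refl
  sumFrom-vanishing f s (suc n) f≈0 =
    trans (+-cong (sumFrom-vanishing f s n (λ t t<n → f≈0 t (ℕP.m<n⇒m<1+n t<n))) (f≈0 n ℕP.≤-refl))
          (+-identityʳ 0#)

  sumFrom-single : ∀ f s u v → (∀ k → k ≢ s ℤ.+ + u → f k ≈ 0#) →
                   sumFrom f s (u ℕ.+ suc v) ≈ f (s ℤ.+ + u)
  sumFrom-single f s u zero    f≈0 = begin
    sumFrom f s (u ℕ.+ 1)          ≡⟨ ≡.cong (sumFrom f s) (ℕP.+-comm u 1) ⟩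
    sumFrom f s u + f (s ℤ.+ + u)  ≈⟨ +-congʳ (sumFrom-vanishing f s u below) ⟩
    0# + f (s ℤ.+ + u)             ≈⟨ +-identityˡ _ ⟩
    f (s ℤ.+ + u)                  ∎
    where
    below : ∀ t → t ℕ.< u → f (s ℤ.+ + t) ≈ 0#
    below t t<u = f≈0 _ (ℕP.<⇒≢ t<u ∘ offset-injective s)
  sumFrom-single f s u (suc v) f≈0 = begin
    sumFrom f s (u ℕ.+ suc (suc v))                        ≡⟨ ≡.cong (sumFrom f s) (ℕP.+-suc u (suc v)) ⟩
    sumFrom f s (u ℕ.+ suc v) + f (s ℤ.+ + (u ℕ.+ suc v))  ≈⟨ +-cong (sumFrom-single f s u v f≈0) (f≈0 _ above) ⟩
    f (s ℤ.+ + u) + 0#                                     ≈⟨ +-identityʳ _ ⟩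
    f (s ℤ.+ + u)                                          ∎
    where
    above : s ℤ.+ + (u ℕ.+ suc v) ≢ s ℤ.+ + u
    above = ℕP.m+1+n≢m u ∘ offset-injective s

  sumFrom-pairs : ∀ f s n →
                  sumFrom f (s ℤ.+ s) (n ℕ.+ n) ≈ sumFrom (λ j → f (j ℤ.+ j) + f (j ℤ.+ j ℤ.+ + 1)) s n
  sumFrom-pairs f s zero    = refl
  sumFrom-pairs f s (suc n) = begin
    sumFrom f (s ℤ.+ s) (suc n ℕ.+ suc n)
      ≡⟨ ≡.cong (λ m → sumFrom f (s ℤ.+ s) (suc m)) (ℕP.+-suc n n) ⟩
    sumFrom f (s ℤ.+ s) (n ℕ.+ n) + f (s ℤ.+ s ℤ.+ + (n ℕ.+ n)) + f (s ℤ.+ s ℤ.+ + suc (n ℕ.+ n))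
      ≈⟨ +-assoc _ _ _ ⟩
    sumFrom f (s ℤ.+ s) (n ℕ.+ n) + (f (s ℤ.+ s ℤ.+ + (n ℕ.+ n)) + f (s ℤ.+ s ℤ.+ + suc (n ℕ.+ n)))
      ≈⟨ +-cong (sumFrom-pairs f s n) (+-cong (reflexive (≡.cong f (even n))) (reflexive (≡.cong f (odd n)))) ⟩
    sumFrom (λ j → f (j ℤ.+ j) + f (j ℤ.+ j ℤ.+ + 1)) s (suc n) ∎
    where
    even : ∀ n → s ℤ.+ s ℤ.+ + (n ℕ.+ n) ≡ (s ℤ.+ + n) ℤ.+ (s ℤ.+ + n)
    even n = arith s (+ n)
      where
      arith : ∀ s n → s ℤ.+ s ℤ.+ (n ℤ.+ n) ≡ (s ℤ.+ n) ℤ.+ (s ℤ.+ n)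
      arith = solve-∀
    odd : ∀ n → s ℤ.+ s ℤ.+ + suc (n ℕ.+ n) ≡ (s ℤ.+ + n) ℤ.+ (s ℤ.+ + n) ℤ.+ + 1
    odd n = arith s (+ n)
      where
      arith : ∀ s n → s ℤ.+ s ℤ.+ (+ 1 ℤ.+ (n ℤ.+ n)) ≡ (s ℤ.+ n) ℤ.+ (s ℤ.+ n) ℤ.+ + 1
      arith = solve-∀

module QSeries {c ℓ : Level} (R : CommutativeRing c ℓ) where
  open CommutativeRing R
  open QDefs R
  open Exponentiation R
  open Summation R
  open ℤ-Solver R using (solve; _:=_; _:+_; _:*_; _:-_; :-_; con)
  open import Algebra.Properties.Ring ring using (-‿involutive)
  open import Relation.Binary.Reasoning.Setoid setoid

  poch-cong : ∀ {a a′ q q′} n → a ≈ a′ → q ≈ q′ → poch a q n ≈ poch a′ q′ n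
  poch-cong zero    a≈a′ q≈q′ = refl
  poch-cong (suc n) a≈a′ q≈q′ =
    *-cong (poch-cong n a≈a′ q≈q′) (+-congˡ (-‿cong (*-cong a≈a′ (^-congˡ n q≈q′))))

  poch-shift : ∀ a q n → poch a q (suc n) ≈ (1# - a) * poch (a * q) q n
  poch-shift a q zero    =
    solve 1 (λ a → con (+ 1) :* (con (+ 1) :- a :* con (+ 1)) := (con (+ 1) :- a) :* con (+ 1)) refl a
  poch-shift a q (suc n) = begin
    poch a q (suc n) * (1# - a * (q * q ^ n))
      ≈⟨ *-cong (poch-shift a q n) (+-congˡ (-‿cong (sym (*-assoc a q (q ^ n))))) ⟩
    (1# - a) * poch (a * q) q n * (1# - a * q * q ^ n)
      ≈⟨ *-assoc _ _ _ ⟩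
    (1# - a) * poch (a * q) q (suc n) ∎

  qbr₀-≢ : ∀ q {m} → m ≢ + 0 → qbr q 0 m ≈ 0#
  qbr₀-≢ q {+ zero}    m≢0 = contradiction ≡.refl m≢0
  qbr₀-≢ q {+ suc m}   m≢0 = refl
  qbr₀-≢ q { -[1+ m ]} m≢0 = refl

  qbr-pascal : ∀ q q⁻ N K → qbr q (suc N) K ≈ qbr q N (K ℤ.- + 1) + zpow q q⁻ K * qbr q N K
  qbr-pascal q q⁻ zero    (+ zero)  = sym (trans (+-identityˡ _) (*-identityˡ 1#))
  qbr-pascal q q⁻ (suc N) (+ zero)  = sym (trans (+-identityˡ _) (*-identityˡ 1#))
  qbr-pascal q q⁻ N       (+ suc k) = refl
  qbr-pascal q q⁻ N       -[1+ k ]  = sym (trans (+-identityˡ _) (zeroʳ _))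

  conjugate-pair : ∀ {y t t⁻} → y * y ≈ - 1# → t * t⁻ ≈ 1# →
                   (1# + y * t⁻) * (1# + y * t) * t ≈ y * (1# + t * t)
  conjugate-pair {y} {t} {t⁻} y²≈-1 tt⁻≈1 = begin
    (1# + y * t⁻) * (1# + y * t) * t
      ≈⟨ solve 3 (λ y t t⁻ → (con (+ 1) :+ y :* t⁻) :* (con (+ 1) :+ y :* t) :* t
                           := t :+ y :* (t :* t) :+ y :* (t :* t⁻) :+ (y :* y) :* (t :* (t :* t⁻))) refl y t t⁻ ⟩
    t + y * (t * t) + y * (t * t⁻) + (y * y) * (t * (t * t⁻))
      ≈⟨ +-cong (+-congˡ (*-congˡ tt⁻≈1)) (*-cong y²≈-1 (*-congˡ tt⁻≈1)) ⟩
    t + y * (t * t) + y * 1# + (- 1#) * (t * 1#)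
      ≈⟨ solve 2 (λ y t → t :+ y :* (t :* t) :+ y :* con (+ 1) :+ (:- con (+ 1)) :* (t :* con (+ 1))
                        := y :* (con (+ 1) :+ t :* t)) refl y t ⟩
    y * (1# + t * t) ∎

  module _ {q q⁻ : Carrier} (qq⁻≈1 : q * q⁻ ≈ 1#) where

    -- The two sides of the bilateral q-binomial theorem; the sum may run over any window of
    -- integers k containing a - N, …, a.

    binomialTerm : ℕ → Carrier → Carrier → ℤ → ℤ → Carrier
    binomialTerm N x x⁻ a k = zpow x x⁻ k * q ^ tri k * qbr q N (a ℤ.- k)

    binomialProduct : ℕ → Carrier → Carrier → ℤ → Carrier
    binomialProduct N x x⁻ a = zpow x x⁻ a * q ^ tri a * poch (- (x⁻ * zpow q q⁻ (+ 1 ℤ.- a))) q N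

    binomialTerm-suc : ∀ N x x⁻ a k →
      binomialTerm (suc N) x x⁻ a k
        ≈ binomialTerm N x x⁻ (a ℤ.- + 1) k + zpow q q⁻ a * binomialTerm N (x * q⁻) (x⁻ * q) a k
    binomialTerm-suc N x x⁻ a k = begin
      X * T * qbr q (suc N) (a ℤ.- k)
        ≈⟨ *-congˡ (qbr-pascal q q⁻ N (a ℤ.- k)) ⟩
      X * T * (qbr q N (a ℤ.- k ℤ.- + 1) + zpow q q⁻ (a ℤ.- k) * B)
        ≈⟨ *-congˡ (+-cong (reflexive (≡.cong (qbr q N) (arith a k))) (*-congʳ (zpow-homo-+ qq⁻≈1 a (ℤ.- k)))) ⟩
      X * T * (B′ + Za * zpow q q⁻ (ℤ.- k) * B)
        ≡⟨ ≡.cong (λ W → X * T * (B′ + Za * W * B)) (zpow-neg q q⁻ k) ⟩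
      X * T * (B′ + Za * W * B)
        ≈⟨ solve 6 (λ X T B′ Za W B → X :* T :* (B′ :+ Za :* W :* B) := X :* T :* B′ :+ Za :* (X :* W :* T :* B))
                   refl X T B′ Za W B ⟩
      X * T * B′ + Za * (X * W * T * B)
        ≈⟨ +-congˡ (*-congˡ (*-congʳ (*-congʳ (zpow-distrib-* x x⁻ q⁻ q k)))) ⟨
      binomialTerm N x x⁻ (a ℤ.- + 1) k + Za * binomialTerm N (x * q⁻) (x⁻ * q) a k ∎
      where
      X = zpow x x⁻ k
      T = q ^ tri k
      W = zpow q⁻ q k
      Za = zpow q q⁻ a
      B = qbr q N (a ℤ.- k)
      B′ = qbr q N (a ℤ.- + 1 ℤ.- k)
      arith : ∀ a k → a ℤ.- k ℤ.- + 1 ≡ a ℤ.- + 1 ℤ.- k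
      arith = solve-∀

    binomialProduct-suc : ∀ N {x x⁻} → x * x⁻ ≈ 1# → ∀ a →
      binomialProduct N x x⁻ (a ℤ.- + 1) + zpow q q⁻ a * binomialProduct N (x * q⁻) (x⁻ * q) a
        ≈ binomialProduct (suc N) x x⁻ a
    binomialProduct-suc N {x} {x⁻} xx⁻≈1 a = begin
      zpow x x⁻ (a ℤ.- + 1) * q ^ tri (a ℤ.- + 1) * poch (- (x⁻ * zpow q q⁻ (+ 1 ℤ.- (a ℤ.- + 1)))) q N
        + Za * (zpow (x * q⁻) (x⁻ * q) a * T * poch (- ((x⁻ * q) * V)) q N)
        ≈⟨ +-cong (*-cong (*-cong (zpow-homo-+ xx⁻≈1 a (ℤ.- + 1)) T′≈) (poch-cong N z′≈ refl))
                  (*-congˡ (*-cong (*-congʳ (zpow-distrib-* x x⁻ q⁻ q a)) (poch-cong N z″≈ refl))) ⟩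
      X * (x⁻ * 1#) * (T * V) * P + Za * (X * Wa * T * P)
        ≈⟨ solve 8 (λ X x⁻ T V P Za Wa o → X :* (x⁻ :* o) :* (T :* V) :* P :+ Za :* (X :* Wa :* T :* P)
                                         := X :* T :* ((x⁻ :* o :* V :+ Za :* Wa) :* P))
                   refl X x⁻ T V P Za Wa 1# ⟩
      X * T * ((x⁻ * 1# * V + Za * Wa) * P)
        ≈⟨ *-congˡ (*-congʳ (trans (+-congˡ (zpow-inverse qq⁻≈1 a)) (1-z≈ x⁻ V))) ⟩
      X * T * ((1# - z) * P)
        ≈⟨ *-congˡ (poch-shift z q N) ⟨
      binomialProduct (suc N) x x⁻ a ∎
      where
      X = zpow x x⁻ a
      T = q ^ tri a
      V = zpow q q⁻ (+ 1 ℤ.- a)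
      Za = zpow q q⁻ a
      Wa = zpow q⁻ q a
      z = - (x⁻ * V)
      P = poch (z * q) q N
      1-z≈ = solve 2 (λ x⁻ V → x⁻ :* con (+ 1) :* V :+ con (+ 1) := con (+ 1) :- (:- (x⁻ :* V))) refl
      T′≈ : q ^ tri (a ℤ.- + 1) ≈ T * V
      T′≈ = trans (reflexive (≡.cong (zpow q q⁻) (tri-pred a))) (zpow-homo-+ qq⁻≈1 (+ tri a) (+ 1 ℤ.- a))
      z′≈ : - (x⁻ * zpow q q⁻ (+ 1 ℤ.- (a ℤ.- + 1))) ≈ z * q
      z′≈ = begin
        - (x⁻ * zpow q q⁻ (+ 1 ℤ.- (a ℤ.- + 1)))  ≡⟨ ≡.cong (λ e → - (x⁻ * zpow q q⁻ e)) (arith a) ⟩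
        - (x⁻ * zpow q q⁻ (+ 1 ℤ.+ (+ 1 ℤ.- a)))  ≈⟨ -‿cong (*-congˡ (zpow-homo-+ qq⁻≈1 (+ 1) (+ 1 ℤ.- a))) ⟩
        - (x⁻ * (q * 1# * V))                     ≈⟨ solve 3 (λ x⁻ q V → :- (x⁻ :* (q :* con (+ 1) :* V)) := :- (x⁻ :* V) :* q)
                                                             refl x⁻ q V ⟩
        z * q                                     ∎
        where
        arith : ∀ a → + 1 ℤ.- (a ℤ.- + 1) ≡ + 1 ℤ.+ (+ 1 ℤ.- a)
        arith = solve-∀
      z″≈ : - ((x⁻ * q) * V) ≈ z * q
      z″≈ = solve 3 (λ x⁻ q V → :- ((x⁻ :* q) :* V) := :- (x⁻ :* V) :* q) refl x⁻ q V

    q-binomial : ∀ N {x x⁻} → x * x⁻ ≈ 1# →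
                 ∀ {s a n} u v → a ≡ s ℤ.+ + (N ℕ.+ u) → n ≡ N ℕ.+ u ℕ.+ suc v →
                 sumFrom (binomialTerm N x x⁻ a) s n ≈ binomialProduct N x x⁻ a
    q-binomial zero {x} {x⁻} xx⁻≈1 {s} u v ≡.refl ≡.refl = begin
      sumFrom (binomialTerm 0 x x⁻ a) s (u ℕ.+ suc v)
        ≈⟨ sumFrom-single _ s u v vanishing ⟩
      zpow x x⁻ a * q ^ tri a * qbr q 0 (a ℤ.- a)
        ≡⟨ ≡.cong (λ m → zpow x x⁻ a * q ^ tri a * qbr q 0 m) (ℤP.+-inverseʳ a) ⟩
      binomialProduct 0 x x⁻ a ∎
      where
      a = s ℤ.+ + u
      vanishing : ∀ k → k ≢ a → binomialTerm 0 x x⁻ a k ≈ 0#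
      vanishing k k≢a = trans (*-congˡ (qbr₀-≢ q (k≢a ∘ ≡.sym ∘ ℤP.i-j≡0⇒i≡j a k))) (zeroʳ _)
    q-binomial (suc N) {x} {x⁻} xx⁻≈1 {s} {a} {n} u v a≡ n≡ = begin
      sumFrom (binomialTerm (suc N) x x⁻ a) s n
        ≈⟨ sumFrom-cong s n (binomialTerm-suc N x x⁻ a) ⟩
      sumFrom (λ k → binomialTerm N x x⁻ (a ℤ.- + 1) k + zpow q q⁻ a * binomialTerm N (x * q⁻) (x⁻ * q) a k) s n
        ≈⟨ trans (sumFrom-distrib-+ _ _ s n) (+-congˡ (sym (*-distribˡ-sumFrom _ _ s n))) ⟩
      sumFrom (binomialTerm N x x⁻ (a ℤ.- + 1)) s n
        + zpow q q⁻ a * sumFrom (binomialTerm N (x * q⁻) (x⁻ * q) a) s n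
        ≈⟨ +-cong (q-binomial N xx⁻≈1 u (suc v) a-1≡ n≡₁)
                  (*-congˡ (q-binomial N xq⁻x⁻q≈1 (suc u) v a≡₂ n≡₂)) ⟩
      binomialProduct N x x⁻ (a ℤ.- + 1) + zpow q q⁻ a * binomialProduct N (x * q⁻) (x⁻ * q) a
        ≈⟨ binomialProduct-suc N xx⁻≈1 a ⟩
      binomialProduct (suc N) x x⁻ a ∎
      where
      arith : ∀ s m → s ℤ.+ (+ 1 ℤ.+ m) ℤ.- + 1 ≡ s ℤ.+ m
      arith = solve-∀
      a-1≡ : a ℤ.- + 1 ≡ s ℤ.+ + (N ℕ.+ u)
      a-1≡ = ≡.trans (≡.cong (ℤ._- + 1) a≡) (arith s (+ (N ℕ.+ u)))
      n≡₁ : n ≡ N ℕ.+ u ℕ.+ suc (suc v)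
      n≡₁ = ≡.trans n≡ (≡.sym (ℕP.+-suc (N ℕ.+ u) (suc v)))
      a≡₂ : a ≡ s ℤ.+ + (N ℕ.+ suc u)
      a≡₂ = ≡.trans a≡ (≡.cong (λ m → s ℤ.+ + m) (≡.sym (ℕP.+-suc N u)))
      n≡₂ : n ≡ N ℕ.+ suc u ℕ.+ suc v
      n≡₂ = ≡.trans n≡ (≡.cong (ℕ._+ suc v) (≡.sym (ℕP.+-suc N u)))
      xq⁻x⁻q≈1 : (x * q⁻) * (x⁻ * q) ≈ 1#
      xq⁻x⁻q≈1 = begin
        (x * q⁻) * (x⁻ * q)  ≈⟨ solve 4 (λ x q⁻ x⁻ q → (x :* q⁻) :* (x⁻ :* q) := (x :* x⁻) :* (q :* q⁻)) refl x q⁻ x⁻ q ⟩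
        (x * x⁻) * (q * q⁻)  ≈⟨ *-cong xx⁻≈1 qq⁻≈1 ⟩
        1# * 1#              ≈⟨ *-identityˡ 1# ⟩
        1#                   ∎

    outer-factors : ∀ {y} → y * y ≈ - 1# → ∀ n →
      (1# - - (y * q⁻ ^ suc n)) * (1# - - (y * q⁻ ^ suc n) * q ^ suc (suc (n ℕ.+ n))) * q ^ suc n
        ≈ y * (1# - - (q * q) * (q * q) ^ n)
    outer-factors {y} y²≈-1 n = begin
      (1# - - (y * t⁻)) * (1# - - (y * t⁻) * q ^ suc (suc (n ℕ.+ n))) * t
        ≈⟨ *-congʳ (*-cong (1-‿-≈ _) (trans (+-congˡ (-‿cong z-outer≈)) (1-‿-≈ _))) ⟩
      (1# + y * t⁻) * (1# + y * t) * t
        ≈⟨ conjugate-pair y²≈-1 (^-inverse qq⁻≈1 (suc n)) ⟩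
      y * (1# + t * t)
        ≈⟨ *-congˡ (+-congˡ (trans (-‿-‿* (q * q) ((q * q) ^ n)) (^-distrib-* q q (suc n)))) ⟨
      y * (1# - - (q * q) * (q * q) ^ n) ∎
      where
      t = q ^ suc n
      t⁻ = q⁻ ^ suc n
      1-‿-≈ : ∀ w → 1# - - w ≈ 1# + w
      1-‿-≈ w = +-congˡ (-‿involutive w)
      -‿-‿* = solve 2 (λ a b → :- (:- a :* b) := a :* b) refl
      z-outer≈ : - (y * t⁻) * q ^ suc (suc (n ℕ.+ n)) ≈ - (y * t)
      z-outer≈ = begin
        - (y * t⁻) * q ^ suc (suc (n ℕ.+ n))  ≡⟨ ≡.cong (λ m → - (y * t⁻) * q ^ suc m) (ℕP.+-suc n n) ⟨
        - (y * t⁻) * q ^ (suc n ℕ.+ suc n)    ≈⟨ *-congˡ (^-homo-* q (suc n) (suc n)) ⟩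
        - (y * t⁻) * (t * t)                  ≈⟨ solve 3 (λ y t t⁻ → :- (y :* t⁻) :* (t :* t) := :- (y :* t) :* (t :* t⁻))
                                                         refl y t t⁻ ⟩
        - (y * t) * (t * t⁻)                  ≈⟨ *-congˡ (^-inverse qq⁻≈1 (suc n)) ⟩
        - (y * t) * 1#                        ≈⟨ *-identityʳ _ ⟩
        - (y * t)                             ∎

    poch-symmetric : ∀ {y} → y * y ≈ - 1# → ∀ n →
      poch (- (y * q⁻ ^ n)) q (suc (n ℕ.+ n)) * q ^ triangle (suc n) ≈ (1# + y) * y ^ n * poch (- (q * q)) (q * q) n
    poch-symmetric {y} y²≈-1 zero =
      solve 1 (λ y → con (+ 1) :* (con (+ 1) :- (:- (y :* con (+ 1))) :* con (+ 1)) :* con (+ 1)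
                   := (con (+ 1) :+ y) :* con (+ 1) :* con (+ 1)) refl y
    poch-symmetric {y} y²≈-1 (suc n) = begin
      poch z q (suc (suc n ℕ.+ suc n)) * q ^ triangle (suc (suc n))
        ≡⟨ ≡.cong (λ m → poch z q (suc (suc m)) * q ^ triangle (suc (suc n))) (ℕP.+-suc n n) ⟩
      poch z q (suc (suc (n ℕ.+ n))) * Fₒ * q ^ (triangle (suc n) ℕ.+ suc n)
        ≈⟨ *-cong (*-congʳ (trans (poch-shift z q (suc (n ℕ.+ n))) (*-congˡ (poch-cong (suc (n ℕ.+ n)) zq≈ refl))))
                  (^-homo-* q (triangle (suc n)) (suc n)) ⟩
      (1# - z) * P * Fₒ * (T * t)
        ≈⟨ solve 5 (λ a P b T t → a :* P :* b :* (T :* t) := P :* T :* (a :* b :* t)) refl (1# - z) P Fₒ T t ⟩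
      P * T * ((1# - z) * Fₒ * t)
        ≈⟨ *-cong (poch-symmetric y²≈-1 n) (outer-factors y²≈-1 n) ⟩
      (1# + y) * y ^ n * Π * (y * f)
        ≈⟨ solve 5 (λ a yⁿ Π y f → a :* yⁿ :* Π :* (y :* f) := a :* (y :* yⁿ) :* (Π :* f))
                   refl (1# + y) (y ^ n) Π y f ⟩
      (1# + y) * y ^ suc n * poch (- (q * q)) (q * q) (suc n) ∎
      where
      t = q ^ suc n
      z = - (y * q⁻ ^ suc n)
      Fₒ = 1# - z * q ^ suc (suc (n ℕ.+ n))
      P = poch (- (y * q⁻ ^ n)) q (suc (n ℕ.+ n))
      T = q ^ triangle (suc n)
      Π = poch (- (q * q)) (q * q) n
      f = 1# - - (q * q) * (q * q) ^ n
      zq≈ : z * q ≈ - (y * q⁻ ^ n)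
      zq≈ = begin
        - (y * (q⁻ * q⁻ ^ n)) * q  ≈⟨ solve 4 (λ y q⁻ r q → :- (y :* (q⁻ :* r)) :* q := :- (y :* r) :* (q :* q⁻))
                                              refl y q⁻ (q⁻ ^ n) q ⟩
        - (y * q⁻ ^ n) * (q * q⁻)  ≈⟨ *-congˡ qq⁻≈1 ⟩
        - (y * q⁻ ^ n) * 1#        ≈⟨ *-identityʳ _ ⟩
        - (y * q⁻ ^ n)             ∎

module RingHomomorphism {c₁ ℓ₁ c₂ ℓ₂ : Level} (R : CommutativeRing c₁ ℓ₁) (S : CommutativeRing c₂ ℓ₂)
  {⟦_⟧ : CommutativeRing.Carrier R → CommutativeRing.Carrier S}
  (isRingHomomorphism : IsRingHomomorphism (CommutativeRing.rawRing R) (CommutativeRing.rawRing S) ⟦_⟧) where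
  private
    module R = CommutativeRing R
    module QR = QDefs R
  open CommutativeRing S
  open QDefs S
  open IsRingHomomorphism isRingHomomorphism

  ⟦⟧-^ : ∀ x n → ⟦ x QR.^ n ⟧ ≈ ⟦ x ⟧ ^ n
  ⟦⟧-^ x zero    = 1#-homo
  ⟦⟧-^ x (suc n) = trans (*-homo x (x QR.^ n)) (*-congˡ (⟦⟧-^ x n))

  ⟦⟧-zpow : ∀ x x⁻ a → ⟦ QR.zpow x x⁻ a ⟧ ≈ zpow ⟦ x ⟧ ⟦ x⁻ ⟧ a
  ⟦⟧-zpow x x⁻ (+ n)    = ⟦⟧-^ x n
  ⟦⟧-zpow x x⁻ -[1+ n ] = ⟦⟧-^ x⁻ (suc n)

  ⟦⟧-gbin : ∀ q N k → ⟦ QR.gbin q N k ⟧ ≈ gbin ⟦ q ⟧ N k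
  ⟦⟧-gbin q zero    zero    = 1#-homo
  ⟦⟧-gbin q zero    (suc k) = 0#-homo
  ⟦⟧-gbin q (suc N) zero    = 1#-homo
  ⟦⟧-gbin q (suc N) (suc k) = trans (+-homo _ _) (+-cong (⟦⟧-gbin q N k)
    (trans (*-homo _ _) (*-cong (⟦⟧-^ q (suc k)) (⟦⟧-gbin q N (suc k)))))

  ⟦⟧-qbr : ∀ q N K → ⟦ QR.qbr q N K ⟧ ≈ qbr ⟦ q ⟧ N K
  ⟦⟧-qbr q N (+ k)    = ⟦⟧-gbin q N k
  ⟦⟧-qbr q N -[1+ k ] = 0#-homo

  ⟦⟧-poch : ∀ a q n → ⟦ QR.poch a q n ⟧ ≈ poch ⟦ a ⟧ ⟦ q ⟧ n
  ⟦⟧-poch a q zero    = 1#-homo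
  ⟦⟧-poch a q (suc n) = trans (*-homo _ _) (*-cong (⟦⟧-poch a q n)
    (trans (+-homo _ _) (+-cong 1#-homo (trans (-‿homo _) (-‿cong (trans (*-homo _ _) (*-congˡ (⟦⟧-^ q n))))))))

module GaussianExtension {c ℓ : Level} (R : CommutativeRing c ℓ) where
  open import Data.Product using (_×_; _,_; proj₁)
  open CommutativeRing R
  open ℤ-Solver R using (solve; _:=_; _:+_; _:*_; _:-_; :-_; con)
  open import Algebra.Properties.Ring ring using (-0#≈0#)
  private
    module G = AbelianGroup (DirectProduct.abelianGroup +-abelianGroup +-abelianGroup)

  infixl 7 _*ᵢ_

  -- (a , b) stands for a + b i
  _*ᵢ_ : Carrier × Carrier → Carrier × Carrier → Carrier × Carrier
  (a , b) *ᵢ (c , d) = (a * c - b * d , a * d + b * c)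

  R[i] : CommutativeRing c ℓ
  R[i] = record
    { _+_ = G._∙_
    ; _*_ = _*ᵢ_
    ; -_  = G._⁻¹
    ; 0#  = G.ε
    ; 1#  = (1# , 0#)
    ; isCommutativeRing = record
      { isRing = record
        { +-isAbelianGroup = G.isAbelianGroup
        ; *-cong = λ (a≈a′ , b≈b′) (c≈c′ , d≈d′) →
              +-cong (*-cong a≈a′ c≈c′) (-‿cong (*-cong b≈b′ d≈d′))
            , +-cong (*-cong a≈a′ d≈d′) (*-cong b≈b′ c≈c′)
        ; *-assoc = λ (a , b) (c , d) (e , f) →
              solve 6 (λ a b c d e f → (a :* c :- b :* d) :* e :- (a :* d :+ b :* c) :* f
                                     := a :* (c :* e :- d :* f) :- b :* (c :* f :+ d :* e)) refl a b c d e f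
            , solve 6 (λ a b c d e f → (a :* c :- b :* d) :* f :+ (a :* d :+ b :* c) :* e
                                     := a :* (c :* f :+ d :* e) :+ b :* (c :* e :- d :* f)) refl a b c d e f
        ; *-identity =
              (λ (a , b) → solve 2 (λ a b → con (+ 1) :* a :- con (+ 0) :* b := a) refl a b
                         , solve 2 (λ a b → con (+ 1) :* b :+ con (+ 0) :* a := b) refl a b)
            , (λ (a , b) → solve 2 (λ a b → a :* con (+ 1) :- b :* con (+ 0) := a) refl a b
                         , solve 2 (λ a b → a :* con (+ 0) :+ b :* con (+ 1) := b) refl a b)
        ; distrib =
              (λ (a , b) (c , d) (e , f) →
                  solve 6 (λ a b c d e f → a :* (c :+ e) :- b :* (d :+ f)
                                         := (a :* c :- b :* d) :+ (a :* e :- b :* f)) refl a b c d e f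
                , solve 6 (λ a b c d e f → a :* (d :+ f) :+ b :* (c :+ e)
                                         := (a :* d :+ b :* c) :+ (a :* f :+ b :* e)) refl a b c d e f)
            , (λ (a , b) (c , d) (e , f) →
                  solve 6 (λ a b c d e f → (c :+ e) :* a :- (d :+ f) :* b
                                         := (c :* a :- d :* b) :+ (e :* a :- f :* b)) refl a b c d e f
                , solve 6 (λ a b c d e f → (c :+ e) :* b :+ (d :+ f) :* a
                                         := (c :* b :+ d :* a) :+ (e :* b :+ f :* a)) refl a b c d e f)
        }
      ; *-comm = λ (a , b) (c , d) →
            solve 4 (λ a b c d → a :* c :- b :* d := c :* a :- d :* b) refl a b c d
          , solve 4 (λ a b c d → a :* d :+ b :* c := c :* b :+ d :* a) refl a b c d
      }
    }

  open CommutativeRing R[i] using () renaming (_≈_ to _≈ᵢ_; 1# to 1ᵢ; _+_ to _+ᵢ_; -_ to -ᵢ_)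

  i ī : Carrier × Carrier
  i = (0# , 1#)
  ī = (0# , - 1#)

  embed : Carrier → Carrier × Carrier
  embed r = (r , 0#)

  re : Carrier × Carrier → Carrier
  re = proj₁

  iī≈1 : i *ᵢ ī ≈ᵢ 1ᵢ
  iī≈1 = solve 0 (con (+ 0) :* con (+ 0) :- con (+ 1) :* (:- con (+ 1)) := con (+ 1)) refl
       , solve 0 (con (+ 0) :* (:- con (+ 1)) :+ con (+ 1) :* con (+ 0) := con (+ 0)) refl

  i²≈-1 : i *ᵢ i ≈ᵢ -ᵢ 1ᵢ
  i²≈-1 = solve 0 (con (+ 0) :* con (+ 0) :- con (+ 1) :* con (+ 1) := :- con (+ 1)) refl
        , solve 0 (con (+ 0) :* con (+ 1) :+ con (+ 1) :* con (+ 0) := :- con (+ 0)) refl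

  ī²≈-1 : ī *ᵢ ī ≈ᵢ -ᵢ 1ᵢ
  ī²≈-1 = solve 0 (con (+ 0) :* con (+ 0) :- (:- con (+ 1)) :* (:- con (+ 1)) := :- con (+ 1)) refl
        , solve 0 (con (+ 0) :* (:- con (+ 1)) :+ (:- con (+ 1)) :* con (+ 0) := :- con (+ 0)) refl

  i[1+ī]≈1+i : i *ᵢ (1ᵢ +ᵢ ī) ≈ᵢ (1# , 1#)
  i[1+ī]≈1+i =
      solve 0 (con (+ 0) :* (con (+ 1) :+ con (+ 0)) :- con (+ 1) :* (con (+ 0) :+ :- con (+ 1)) := con (+ 1)) refl
    , solve 0 (con (+ 0) :* (con (+ 0) :+ :- con (+ 1)) :+ con (+ 1) :* (con (+ 1) :+ con (+ 0)) := con (+ 1)) refl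

  embed-isRingHomomorphism : IsRingHomomorphism rawRing (CommutativeRing.rawRing R[i]) embed
  embed-isRingHomomorphism = record
    { isSemiringHomomorphism = record
      { isNearSemiringHomomorphism = record
        { +-isMonoidHomomorphism = record
          { isMagmaHomomorphism = record
            { isRelHomomorphism = record { cong = λ x≈y → x≈y , refl }
            ; homo = λ x y → refl , sym (+-identityʳ 0#)
            }
          ; ε-homo = refl , refl
          }
        ; *-homo = λ x y → solve 2 (λ x y → x :* y := x :* y :- con (+ 0) :* con (+ 0)) refl x y
                         , solve 2 (λ x y → con (+ 0) := x :* con (+ 0) :+ con (+ 0) :* y) refl x y
        }
      ; 1#-homo = refl , refl
      }
    ; -‿homo = λ x → refl , sym -0#≈0#
    }

  re-embed-* : ∀ r w → re (embed r *ᵢ w) ≈ r * re w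
  re-embed-* r (a , b) = solve 3 (λ r a b → r :* a :- con (+ 0) :* b := r :* a) refl r a b

  re-imaginary : ∀ b r → re ((0# , b) *ᵢ embed r) ≈ 0#
  re-imaginary b r = solve 2 (λ b r → con (+ 0) :* r :- b :* con (+ 0) := con (+ 0)) refl b r

  1+ī*embed : ∀ u → 1ᵢ +ᵢ ī *ᵢ embed u ≈ᵢ (1# , - u)
  1+ī*embed u = solve 1 (λ u → con (+ 1) :+ (con (+ 0) :* u :- (:- con (+ 1)) :* con (+ 0)) := con (+ 1)) refl u
              , solve 1 (λ u → con (+ 0) :+ (con (+ 0) :* con (+ 0) :+ (:- con (+ 1)) :* u) := :- u) refl u

  *[1-iu] : ∀ a b u → (a , b) *ᵢ (1# , - u) ≈ᵢ (a + b * u , b - a * u)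
  *[1-iu] a b u = solve 3 (λ a b u → a :* con (+ 1) :- b :* (:- u) := a :+ b :* u) refl a b u
                , solve 3 (λ a b u → a :* (:- u) :+ b :* con (+ 1) := b :- a :* u) refl a b u

  re-sumFrom : ∀ f s n → re (QDefs.sumFrom R[i] f s n) ≈ QDefs.sumFrom R (λ k → re (f k)) s n
  re-sumFrom f s zero    = refl
  re-sumFrom f s (suc n) = +-congʳ (re-sumFrom f s n)

module Evaluation {c ℓ : Level} (R : CommutativeRing c ℓ) {q q⁻ : CommutativeRing.Carrier R}
  (qq⁻≈1 : CommutativeRing._≈_ R (CommutativeRing._*_ R q q⁻) (CommutativeRing.1# R)) where
  open import Data.Product using (_×_; _,_; proj₁)
  open CommutativeRing R
  open QDefs R
  open Summation R
  open GaussianExtension R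
  open RingHomomorphism R R[i] embed-isRingHomomorphism
  open QSeries R[i] using (q-binomial; binomialTerm; binomialProduct; poch-cong; poch-symmetric)
  private
    module Rᵢ = CommutativeRing R[i]
    module Qᵢ = QDefs R[i]
    module Eᵢ = Exponentiation R[i]
    module embed = IsRingHomomorphism embed-isRingHomomorphism
  open Rᵢ using () renaming (_≈_ to _≈ᵢ_; 1# to 1ᵢ; _+_ to _+ᵢ_; _-_ to _-ᵢ_; -_ to -ᵢ_)

  Q Q⁻ : Carrier × Carrier
  Q = embed q
  Q⁻ = embed q⁻

  QQ⁻≈1 : Q *ᵢ Q⁻ ≈ᵢ 1ᵢ
  QQ⁻≈1 = Rᵢ.trans (Rᵢ.sym (embed.*-homo q q⁻)) (embed.⟦⟧-cong qq⁻≈1)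

  shift : ℕ → ℤ
  shift L = + L ℤ.- + 1

  summand : ℕ → ℤ → Carrier × Carrier
  summand L = binomialTerm QQ⁻≈1 (2 ℕ.* L) i ī (shift L)

  product : ℕ → Carrier × Carrier
  product L = binomialProduct QQ⁻≈1 (2 ℕ.* L) i ī (shift L)

  summand≈iᵏ*embed : ∀ L k →
    summand L k ≈ᵢ Qᵢ.zpow i ī k *ᵢ embed (q ^ tri k * qbr q (2 ℕ.* L) (shift L ℤ.- k))
  summand≈iᵏ*embed L k = Rᵢ.trans (Rᵢ.*-assoc _ _ _) (Rᵢ.*-congˡ (Rᵢ.sym (Rᵢ.trans (embed.*-homo _ _)
    (Rᵢ.*-cong (⟦⟧-^ q (tri k)) (⟦⟧-qbr q (2 ℕ.* L) (shift L ℤ.- k))))))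

  i^even : ∀ j → Qᵢ.zpow i ī (j ℤ.+ j) ≈ᵢ embed (zpow (- 1#) (- 1#) j)
  i^even j = begin
    Qᵢ.zpow i ī (j ℤ.+ j)                    ≈⟨ Eᵢ.zpow-homo-+ iī≈1 j j ⟩
    Qᵢ.zpow i ī j *ᵢ Qᵢ.zpow i ī j            ≈⟨ Eᵢ.zpow-distrib-* i ī i ī j ⟨
    Qᵢ.zpow (i *ᵢ i) (ī *ᵢ ī) j               ≈⟨ Eᵢ.zpow-cong j (-1≈ i²≈-1) (-1≈ ī²≈-1) ⟩
    Qᵢ.zpow (embed (- 1#)) (embed (- 1#)) j  ≈⟨ ⟦⟧-zpow (- 1#) (- 1#) j ⟨
    embed (zpow (- 1#) (- 1#) j)             ∎
    where
    open import Relation.Binary.Reasoning.Setoid Rᵢ.setoid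
    -1≈ : ∀ {x} → x ≈ᵢ -ᵢ 1ᵢ → x ≈ᵢ embed (- 1#)
    -1≈ x≈-1 = Rᵢ.trans x≈-1 (Rᵢ.sym (embed.-‿homo 1#))

  summand-even : ∀ L j → summand L (j ℤ.+ j) ≈ᵢ embed (term q q⁻ L j)
  summand-even L j = begin
    summand L (j ℤ.+ j)
      ≈⟨ Rᵢ.trans (summand≈iᵏ*embed L (j ℤ.+ j)) (Rᵢ.*-congʳ (i^even j)) ⟩
    embed ε *ᵢ embed (q ^ tri (j ℤ.+ j) * qbr q (2 ℕ.* L) (shift L ℤ.- (j ℤ.+ j)))
      ≈⟨ embed.*-homo _ _ ⟨
    embed (ε * (q ^ tri (j ℤ.+ j) * qbr q (2 ℕ.* L) (shift L ℤ.- (j ℤ.+ j))))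
      ≡⟨ ≡.cong₂ (λ e m → embed (ε * (zpow q q⁻ e * qbr q (2 ℕ.* L) m))) (tri-double j) (arith (+ L) j) ⟩
    embed (ε * (zpow q q⁻ (+ 2 ℤ.* j ℤ.* j ℤ.- j) * qbr q (2 ℕ.* L) (+ L ℤ.- + 2 ℤ.* j ℤ.- + 1)))
      ≈⟨ embed.⟦⟧-cong (*-assoc _ _ _) ⟨
    embed (term q q⁻ L j) ∎
    where
    open import Relation.Binary.Reasoning.Setoid Rᵢ.setoid
    ε = zpow (- 1#) (- 1#) j
    arith : ∀ L j → L ℤ.- + 1 ℤ.- (j ℤ.+ j) ≡ L ℤ.- + 2 ℤ.* j ℤ.- + 1
    arith = solve-∀

  re-summand-odd : ∀ L j → re (summand L (j ℤ.+ j ℤ.+ + 1)) ≈ 0#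
  re-summand-odd L j = trans (proj₁ (begin
    summand L k                      ≈⟨ summand≈iᵏ*embed L k ⟩
    Qᵢ.zpow i ī k *ᵢ embed r          ≈⟨ Rᵢ.*-congʳ (Rᵢ.trans (Eᵢ.zpow-homo-+ iī≈1 (j ℤ.+ j) (+ 1)) (Rᵢ.*-congʳ (i^even j))) ⟩
    embed s *ᵢ (i *ᵢ 1ᵢ) *ᵢ embed r   ≈⟨ solve 3 (λ s i r → s :* (i :* con (+ 1)) :* r := i :* (s :* r)) Rᵢ.refl (embed s) i (embed r) ⟩
    i *ᵢ (embed s *ᵢ embed r)        ≈⟨ Rᵢ.*-congˡ (embed.*-homo s r) ⟨
    i *ᵢ embed (s * r)               ∎)) (re-imaginary 1# (s * r))
    where
    open import Relation.Binary.Reasoning.Setoid Rᵢ.setoid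
    open ℤ-Solver R[i] using (solve; _:=_; _:*_; con)
    k = j ℤ.+ j ℤ.+ + 1
    s = zpow (- 1#) (- 1#) j
    r = q ^ tri k * qbr q (2 ℕ.* L) (shift L ℤ.- k)

  lhs≈re-product : ∀ L → lhs q q⁻ L ≈ re (product L)
  lhs≈re-product L = begin
    sumFrom (term q q⁻ L) s n
      ≈⟨ sumFrom-cong s n (λ j → sym (trans (+-cong (proj₁ (summand-even L j)) (re-summand-odd L j)) (+-identityʳ _))) ⟩
    sumFrom (λ j → re (summand L (j ℤ.+ j)) + re (summand L (j ℤ.+ j ℤ.+ + 1))) s n
      ≈⟨ sumFrom-pairs (λ k → re (summand L k)) s n ⟨
    sumFrom (λ k → re (summand L k)) (s ℤ.+ s) (n ℕ.+ n)
      ≈⟨ re-sumFrom (summand L) (s ℤ.+ s) (n ℕ.+ n) ⟨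
    re (Qᵢ.sumFrom (summand L) (s ℤ.+ s) (n ℕ.+ n))
      ≈⟨ proj₁ (q-binomial QQ⁻≈1 (2 ℕ.* L) iī≈1 (suc L) (suc (suc L)) shift≡ length≡) ⟩
    re (product L) ∎
    where
    open import Relation.Binary.Reasoning.Setoid setoid
    s = ℤ.- (+ suc L)
    n = 2 ℕ.* L ℕ.+ 2
    shift≡ : shift L ≡ s ℤ.+ s ℤ.+ + (2 ℕ.* L ℕ.+ suc L)
    shift≡ = ≡.trans (arith (+ L)) (≡.cong (λ m → s ℤ.+ s ℤ.+ (m ℤ.+ + suc L)) (≡.sym (ℤP.pos-* 2 L)))
      where
      arith : ∀ L → L ℤ.- + 1 ≡ ℤ.- (+ 1 ℤ.+ L) ℤ.+ ℤ.- (+ 1 ℤ.+ L) ℤ.+ (+ 2 ℤ.* L ℤ.+ (+ 1 ℤ.+ L))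
      arith = solve-∀
    length≡ : n ℕ.+ n ≡ 2 ℕ.* L ℕ.+ suc L ℕ.+ suc (suc (suc L))
    length≡ = arith L
      where
      arith : ∀ L → 2 ℕ.* L ℕ.+ 2 ℕ.+ (2 ℕ.* L ℕ.+ 2) ≡ 2 ℕ.* L ℕ.+ (1 ℕ.+ L) ℕ.+ (3 ℕ.+ L)
      arith = ℕ-solve-∀

  poch-factor : ∀ w e u → w *ᵢ Q Qᵢ.^ e ≈ᵢ embed u → 1ᵢ -ᵢ (-ᵢ (ī *ᵢ w)) *ᵢ Q Qᵢ.^ e ≈ᵢ (1# , - u)
  poch-factor w e u wQᵉ≈u = begin
    1ᵢ -ᵢ (-ᵢ (ī *ᵢ w)) *ᵢ Q Qᵢ.^ e
      ≈⟨ solve 3 (λ ī w X → con (+ 1) :- (:- (ī :* w)) :* X := con (+ 1) :+ ī :* (w :* X)) Rᵢ.refl ī w (Q Qᵢ.^ e) ⟩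
    1ᵢ +ᵢ ī *ᵢ (w *ᵢ Q Qᵢ.^ e)  ≈⟨ Rᵢ.+-congˡ (Rᵢ.*-congˡ wQᵉ≈u) ⟩
    1ᵢ +ᵢ ī *ᵢ embed u         ≈⟨ 1+ī*embed u ⟩
    (1# , - u)                 ∎
    where
    open import Relation.Binary.Reasoning.Setoid Rᵢ.setoid
    open ℤ-Solver R[i] using (solve; _:=_; _:+_; _:*_; _:-_; :-_; con)

  re-product₀ : re (product 0) ≈ 0#
  re-product₀ = trans (proj₁ (solve 2 (λ ī Q → ī :* con (+ 1) :* (Q :* con (+ 1)) :* con (+ 1) := ī :* Q) Rᵢ.refl ī Q))
                      (re-imaginary (- 1#) q)
    where open ℤ-Solver R[i] using (solve; _:=_; _:*_; con)

  re-product₁ : re (product 1) ≈ 1# * 1# - (- (q * 1#)) * (- (q * (q * 1#)))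
  re-product₁ = proj₁ (begin
    1ᵢ *ᵢ 1ᵢ *ᵢ (1ᵢ *ᵢ F₀ *ᵢ F₁)
      ≈⟨ solve 2 (λ F₀ F₁ → con (+ 1) :* con (+ 1) :* (con (+ 1) :* F₀ :* F₁) := F₀ :* F₁) Rᵢ.refl F₀ F₁ ⟩
    F₀ *ᵢ F₁
      ≈⟨ Rᵢ.*-cong (poch-factor (Q Qᵢ.^ 1) 0 (q ^ 1) Q¹Q⁰≈) (poch-factor (Q Qᵢ.^ 1) 1 (q ^ 2) Q¹Q¹≈) ⟩
    (1# , - q ^ 1) *ᵢ (1# , - q ^ 2) ∎)
    where
    open import Relation.Binary.Reasoning.Setoid Rᵢ.setoid
    open ℤ-Solver R[i] using (solve; _:=_; _:*_; con)
    z = -ᵢ (ī *ᵢ Q Qᵢ.^ 1)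
    F₀ = 1ᵢ -ᵢ z *ᵢ Q Qᵢ.^ 0
    F₁ = 1ᵢ -ᵢ z *ᵢ Q Qᵢ.^ 1
    Q¹Q⁰≈ : Q Qᵢ.^ 1 *ᵢ Q Qᵢ.^ 0 ≈ᵢ embed (q ^ 1)
    Q¹Q⁰≈ = Rᵢ.trans (Rᵢ.*-identityʳ _) (Rᵢ.sym (⟦⟧-^ q 1))
    Q¹Q¹≈ : Q Qᵢ.^ 1 *ᵢ Q Qᵢ.^ 1 ≈ᵢ embed (q ^ 2)
    Q¹Q¹≈ = Rᵢ.trans (Rᵢ.sym (Eᵢ.^-homo-* Q 1 1)) (Rᵢ.sym (⟦⟧-^ q 2))

  product₂₊ : ∀ n → product (suc (suc n)) ≈ᵢ embed (poch (- (q * q)) (q * q) n) *ᵢ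
    ((1# , 1#) *ᵢ (1# , - q ^ suc n) *ᵢ (1# , - q ^ suc (suc n)) *ᵢ (1# , - q ^ suc (suc (suc n))))
  product₂₊ n = begin
    i *ᵢ iⁿ *ᵢ T *ᵢ Qᵢ.poch z Q (2 ℕ.* suc (suc n))
      ≈⟨ Rᵢ.*-congˡ (Rᵢ.trans (Rᵢ.reflexive (≡.cong (Qᵢ.poch z Q) length≡)) (poch-cong (4 ℕ.+ (n ℕ.+ n)) z≈ Rᵢ.refl)) ⟩
    i *ᵢ iⁿ *ᵢ T *ᵢ (P *ᵢ F₁ *ᵢ F₂ *ᵢ F₃)
      ≈⟨ solve 7 (λ i iⁿ T P F₁ F₂ F₃ → i :* iⁿ :* T :* (P :* F₁ :* F₂ :* F₃) := i :* iⁿ :* (P :* T) :* (F₁ :* F₂ :* F₃))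
                 Rᵢ.refl i iⁿ T P F₁ F₂ F₃ ⟩
    i *ᵢ iⁿ *ᵢ (P *ᵢ T) *ᵢ (F₁ *ᵢ F₂ *ᵢ F₃)
      ≈⟨ Rᵢ.*-congʳ (Rᵢ.*-congˡ (poch-symmetric QQ⁻≈1 ī²≈-1 n)) ⟩
    i *ᵢ iⁿ *ᵢ ((1ᵢ +ᵢ ī) *ᵢ īⁿ *ᵢ Π) *ᵢ (F₁ *ᵢ F₂ *ᵢ F₃)
      ≈⟨ solve 8 (λ i iⁿ ī īⁿ Π F₁ F₂ F₃ → i :* iⁿ :* ((con (+ 1) :+ ī) :* īⁿ :* Π) :* (F₁ :* F₂ :* F₃)
                                          := Π :* (iⁿ :* īⁿ) :* (i :* (con (+ 1) :+ ī) :* F₁ :* F₂ :* F₃))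
                 Rᵢ.refl i iⁿ ī īⁿ Π F₁ F₂ F₃ ⟩
    Π *ᵢ (iⁿ *ᵢ īⁿ) *ᵢ (i *ᵢ (1ᵢ +ᵢ ī) *ᵢ F₁ *ᵢ F₂ *ᵢ F₃)
      ≈⟨ Rᵢ.*-cong (Rᵢ.trans (Rᵢ.*-congˡ (Eᵢ.^-inverse iī≈1 n)) (Rᵢ.*-identityʳ Π))
                   (Rᵢ.*-cong (Rᵢ.*-cong (Rᵢ.*-cong i[1+ī]≈1+i (factor 1)) (factor 2)) (factor 3)) ⟩
    Π *ᵢ ((1# , 1#) *ᵢ (1# , - q ^ suc n) *ᵢ (1# , - q ^ suc (suc n)) *ᵢ (1# , - q ^ suc (suc (suc n))))
      ≈⟨ Rᵢ.*-congʳ Π≈ ⟩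
    embed (poch (- (q * q)) (q * q) n) *ᵢ
      ((1# , 1#) *ᵢ (1# , - q ^ suc n) *ᵢ (1# , - q ^ suc (suc n)) *ᵢ (1# , - q ^ suc (suc (suc n)))) ∎
    where
    open import Relation.Binary.Reasoning.Setoid Rᵢ.setoid
    open ℤ-Solver R[i] using (solve; _:=_; _:+_; _:*_; con)
    iⁿ = i Qᵢ.^ n
    īⁿ = ī Qᵢ.^ n
    T = Q Qᵢ.^ triangle (suc n)
    z = -ᵢ (ī *ᵢ Qᵢ.zpow Q Q⁻ (+ 1 ℤ.- + suc n))
    z′ = -ᵢ (ī *ᵢ Q⁻ Qᵢ.^ n)
    P = Qᵢ.poch z′ Q (suc (n ℕ.+ n))
    F : ℕ → Carrier × Carrier
    F k = 1ᵢ -ᵢ z′ *ᵢ Q Qᵢ.^ (k ℕ.+ (n ℕ.+ n))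
    F₁ = F 1
    F₂ = F 2
    F₃ = F 3
    Π = Qᵢ.poch (-ᵢ (Q *ᵢ Q)) (Q *ᵢ Q) n
    length≡ : 2 ℕ.* suc (suc n) ≡ 4 ℕ.+ (n ℕ.+ n)
    length≡ = arith n
      where
      arith : ∀ n → 2 ℕ.* (2 ℕ.+ n) ≡ 4 ℕ.+ (n ℕ.+ n)
      arith = ℕ-solve-∀
    z≈ : z ≈ᵢ z′
    z≈ = Rᵢ.-‿cong (Rᵢ.*-congˡ (Rᵢ.reflexive (≡.trans (≡.cong (Qᵢ.zpow Q Q⁻) (arith (+ n))) (Eᵢ.zpow-neg Q Q⁻ (+ n)))))
      where
      arith : ∀ n → + 1 ℤ.- (+ 1 ℤ.+ n) ≡ ℤ.- n
      arith = solve-∀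
    factor : ∀ k → F k ≈ᵢ (1# , - q ^ (k ℕ.+ n))
    factor k = poch-factor (Q⁻ Qᵢ.^ n) (k ℕ.+ (n ℕ.+ n)) (q ^ (k ℕ.+ n)) (begin
      Q⁻ Qᵢ.^ n *ᵢ Q Qᵢ.^ (k ℕ.+ (n ℕ.+ n))  ≡⟨ ≡.cong (λ e → Q⁻ Qᵢ.^ n *ᵢ Q Qᵢ.^ e) (arith k n) ⟩
      Q⁻ Qᵢ.^ n *ᵢ Q Qᵢ.^ (n ℕ.+ (k ℕ.+ n))  ≈⟨ Eᵢ.^-cancelˡ QQ⁻≈1 n (k ℕ.+ n) ⟩
      Q Qᵢ.^ (k ℕ.+ n)                     ≈⟨ ⟦⟧-^ q (k ℕ.+ n) ⟨
      embed (q ^ (k ℕ.+ n))                ∎)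
      where
      arith : ∀ k n → k ℕ.+ (n ℕ.+ n) ≡ n ℕ.+ (k ℕ.+ n)
      arith = ℕ-solve-∀
    Π≈ : Π ≈ᵢ embed (poch (- (q * q)) (q * q) n)
    Π≈ = Rᵢ.sym (Rᵢ.trans (⟦⟧-poch (- (q * q)) (q * q) n)
                          (poch-cong n (Rᵢ.trans (embed.-‿homo (q * q)) (Rᵢ.-‿cong (embed.*-homo q q))) (embed.*-homo q q)))

  re-product₂₊ : ∀ n → let u₁ = q ^ suc n; u₂ = q ^ suc (suc n) in
    re (product (suc (suc n))) ≈ poch (- (q * q)) (q * q) n * ((1# + u₂) * (1# - u₂ * u₂) + u₁ * (1# - u₂) * (1# + q ^ 2))
  re-product₂₊ n = begin
    re (product (suc (suc n)))
      ≈⟨ proj₁ (product₂₊ n) ⟩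
    re (embed Π *ᵢ ((1# , 1#) *ᵢ (1# , - u₁) *ᵢ (1# , - u₂) *ᵢ (1# , - u₃)))
      ≈⟨ re-embed-* Π _ ⟩
    Π * re ((1# , 1#) *ᵢ (1# , - u₁) *ᵢ (1# , - u₂) *ᵢ (1# , - u₃))
      ≈⟨ *-congˡ (proj₁ (Rᵢ.trans (Rᵢ.*-congʳ (Rᵢ.trans (Rᵢ.*-congʳ (*[1-iu] 1# 1# u₁)) (*[1-iu] _ _ u₂))) (*[1-iu] _ _ u₃))) ⟩
    Π * (a₂ + b₂ * u₃)
      ≈⟨ solve 3 (λ Π q t → let u₁ = q :* t; u₂ = q :* u₁; u₃ = q :* u₂
                                a₁ = con (+ 1) :+ con (+ 1) :* u₁; b₁ = con (+ 1) :- con (+ 1) :* u₁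
                                a₂ = a₁ :+ b₁ :* u₂; b₂ = b₁ :- a₁ :* u₂
                            in Π :* (a₂ :+ b₂ :* u₃)
                               := Π :* ((con (+ 1) :+ u₂) :* (con (+ 1) :- u₂ :* u₂)
                                        :+ u₁ :* (con (+ 1) :- u₂) :* (con (+ 1) :+ q :* (q :* con (+ 1)))))
                 refl Π q (q ^ n) ⟩
    Π * ((1# + u₂) * (1# - u₂ * u₂) + u₁ * (1# - u₂) * (1# + q ^ 2)) ∎
    where
    open import Relation.Binary.Reasoning.Setoid setoid
    open ℤ-Solver R using (solve; _:=_; _:+_; _:*_; _:-_; con)
    Π = poch (- (q * q)) (q * q) n
    u₁ = q ^ suc n
    u₂ = q ^ suc (suc n)
    u₃ = q ^ suc (suc (suc n))
    a₁ = 1# + 1# * u₁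
    b₁ = 1# - 1# * u₁
    a₂ = a₁ + b₁ * u₂
    b₂ = b₁ - a₁ * u₂

  re-product≈ : ∀ L d → d * pochDen (- (q * q)) (q * q) (q⁻ * q⁻) (+ L ℤ.- + 2) ≈ 1# →
                re (product L) ≈ (pochNum (- (q * q)) (q * q) (q⁻ * q⁻) (+ L ℤ.- + 2) * d) * braces q q⁻ L
  re-product≈ zero d _ = trans re-product₀ (solve 3 (λ d q q⁻ →
    con (+ 0) := con (+ 1) :* d :* ((con (+ 1) :+ con (+ 1)) :* (con (+ 1) :- con (+ 1))
                                   :+ q⁻ :* con (+ 1) :* (con (+ 1) :- con (+ 1)) :* (con (+ 1) :+ q :* (q :* con (+ 1)))))
    refl d q q⁻)
    where open ℤ-Solver R using (solve; _:=_; _:+_; _:*_; _:-_; con)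
  re-product≈ (suc zero) d d·pochDen≈1 = begin
    re (product 1)
      ≈⟨ re-product₁ ⟩
    1# * 1# - (- (q * 1#)) * (- (q * (q * 1#)))
      ≈⟨ solve 1 (λ q → con (+ 1) :* con (+ 1) :- (:- (q :* con (+ 1))) :* (:- (q :* (q :* con (+ 1))))
                      := con (+ 1) :* (con (+ 1) :- q :* (q :* q))) refl q ⟩
    1# * (1# - q * (q * q))
      ≈⟨ *-congʳ 2d≈1 ⟨
    d * (1# + 1#) * (1# - q * (q * q))
      ≈⟨ solve 2 (λ d q → d :* (con (+ 1) :+ con (+ 1)) :* (con (+ 1) :- q :* (q :* q))
                        := con (+ 1) :* d :* ((con (+ 1) :+ q :* con (+ 1)) :* (con (+ 1) :- q :* (q :* con (+ 1)))
                                             :+ con (+ 1) :* (con (+ 1) :- q :* con (+ 1)) :* (con (+ 1) :+ q :* (q :* con (+ 1)))))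
                 refl d q ⟩
    (1# * d) * braces q q⁻ 1 ∎
    where
    open import Relation.Binary.Reasoning.Setoid setoid
    open ℤ-Solver R using (solve; _:=_; _:+_; _:*_; _:-_; :-_; con)
    2d≈1 : d * (1# + 1#) ≈ 1#
    2d≈1 = begin
      d * (1# + 1#)
        ≈⟨ *-congˡ (+-congˡ (trans (*-cong qq⁻≈1 qq⁻≈1) (*-identityˡ 1#))) ⟨
      d * (1# + (q * q⁻) * (q * q⁻))
        ≈⟨ solve 3 (λ d q q⁻ → d :* (con (+ 1) :+ (q :* q⁻) :* (q :* q⁻))
                             := d :* (con (+ 1) :* (con (+ 1) :- (:- (q :* q)) :* (q⁻ :* q⁻) :* con (+ 1)))) refl d q q⁻ ⟩
      d * (1# * (1# - (- (q * q)) * (q⁻ * q⁻) * 1#))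
        ≈⟨ d·pochDen≈1 ⟩
      1# ∎
  re-product≈ (suc (suc n)) d d≈1 = begin
    re (product (suc (suc n)))
      ≈⟨ re-product₂₊ n ⟩
    Π * ((1# + u₂) * (1# - u₂ * u₂) + u₁ * (1# - u₂) * (1# + q ^ 2))
      ≈⟨ *-cong (trans (*-congˡ (trans (sym (*-identityʳ d)) d≈1)) (*-identityʳ Π))
                (+-congʳ (*-congˡ (+-congˡ (-‿cong q^2L≈)))) ⟨
    (Π * d) * braces q q⁻ (suc (suc n)) ∎
    where
    open import Relation.Binary.Reasoning.Setoid setoid
    open Exponentiation R using (^-homo-*)
    Π = poch (- (q * q)) (q * q) n
    u₁ = q ^ suc n
    u₂ = q ^ suc (suc n)
    q^2L≈ : q ^ (2 ℕ.* suc (suc n)) ≈ u₂ * u₂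
    q^2L≈ = trans (reflexive (≡.cong (q ^_) (arith (suc (suc n))))) (^-homo-* q (suc (suc n)) (suc (suc n)))
      where
      arith : ∀ L → 2 ℕ.* L ≡ L ℕ.+ L
      arith = ℕ-solve-∀

theorem3p1 : {c ℓ : Level} (R : CommutativeRing c ℓ) →
    let open CommutativeRing R in
    let open QDefs R in
    (q q⁻ : Carrier) → q * q⁻ ≈ 1# → (L : ℕ) →
    (d : Carrier) →
    d * pochDen (- (q * q)) (q * q) (q⁻ * q⁻) (+ L ℤ.- + 2) ≈ 1# →
    lhs q q⁻ L ≈ (pochNum (- (q * q)) (q * q) (q⁻ * q⁻) (+ L ℤ.- + 2) * d) * braces q q⁻ L
theorem3p1 R q q⁻ qq⁻≈1 L d d-inverse = trans (lhs≈re-product L) (re-product≈ L d d-inverse)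
  where
  open CommutativeRing R using (trans)
  open Evaluation R qq⁻≈1
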